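{- Let $(A,L)$ and $(B,M)$ be live automata with the same external actions. Let $R\subseteq\mathit{states}(A)\times\mathit{states}(B)$ and let $H:M\to\widehat L$ be a total mapping. Let $\alpha$ and $\alpha'$ be infinite executions of $A$ and $B$ respectively. If $(\alpha,\alpha')\in(R,H)$, then $\alpha\in\mathit{lexecs}(A,L)$ implies $\alpha'\in\mathit{lexecs}(B,M)$.
   Context: An automaton has states, start states, disjoint external/internal actions, and transitions. An execution is an alternating sequence $s_0a_1s_1\ldots$ of states and actions starting in a start state and following transitions; $|\alpha|$ is its number of actions; $\mathit{execs}^\omega(A)$ denotes infinite executions. Trace of an action: itself if external, empty otherwise; traces of action sequences concatenate. Same external actions: equal external action sets. Complemented pair $p=\langle p.\mathsf{R},p.\mathsf{G}\rangle$ of state sets; infinite $\alpha\models p$ iff (infinitely many positions of $\alpha$ carry states in $p.\mathsf{R}$ implies infinitely many carry states in $p.\mathsf{G}$). Live automaton $(A,L)$: $L$ a set (any cardinality) of complemented pairs such that every finite execution has a proper infinite extension execution satisfying all of $L$. $\mathit{lexecs}(A,L)=\{\alpha\in\mathit{execs}^\omega(A)\mid\forall p\in L:\alpha\models p\}$; $\widehat L$ = set of complemented pairs over $A$ satisfied by every element of $\mathit{lexecs}(A,L)$. $(\alpha,\alpha')\in(R,H)$ for $\alpha=s_0a_1s_1\ldots$, $\alpha'=u_0b_1u_1\ldots$ means there is a total nondecreasing $m:\{0,\ldots,|\alpha|\}\to\{0,\ldots,|\alpha'|\}$ with: $m(0)=0$; $(s_i,u_{m(i)})\in R$ for all $i$;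 for $0<i\le|\alpha|$ the trace of $b_{m(i-1)+1}\cdots b_{m(i)}$ (empty if $m(i-1)=m(i)$) equals the trace of $a_i$; for every $j\le|\alpha'|$ some $i$ has $m(i)\ge j$; and for all $q\in M$ and $0<i\le|\alpha|$, with $p=H(q)$: if some $u_j$ with $m(i-1)\le j\le m(i)$ is in $q.\mathsf{R}$ then $s_{i-1}\in p.\mathsf{R}$ or $s_i\in p.\mathsf{R}$; and if $s_{i-1}\in p.\mathsf{G}$ or $s_i\in p.\mathsf{G}$ then some $u_j$ with $m(i-1)\le j\le m(i)$ is in $q.\mathsf{G}$. -}

module Defs where

open import Data.Nat using (ℕ; zero; suc; _+_; _∸_; _≤_; _<_)
open import Data.Bool using (Bool; true; false)
open import Data.List using (List; []; _∷_; _++_; map; upTo)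
open import Data.Product using (Σ; ∃; _×_; _,_)
open import Data.Sum using (_⊎_)
open import Data.Empty using (⊥)
open import Relation.Binary.PropositionalEquality using (_≡_)

-- Automata over a common ambient universe of action names `Act`.
record Automaton (Act : Set) : Set₁ where
  field
    State    : Set
    start    : State → Set
    ext      : Act → Bool
    int      : Act → Set
    disjoint : ∀ a → int a → ext a ≡ false
    trans    : State → Act → State → Set
    trans-act : ∀ {s a s'} → trans s a s' → (ext a ≡ true) ⊎ int a

open Automaton public

SameExt : {Act : Set} → Automaton Act → Automaton Act → Set
SameExt {Act} A B = ∀ (a : Act) → ext A a ≡ ext B a

trace : {Act : Set} → (Act → Bool) → List Act → List Act
trace e [] = []
trace e (a ∷ as) with e a
... | true  = a ∷ trace e as
... | false = trace e as

-- Infinite execution s₀ a₁ s₁ a₂ …: `st i` = s_i, `act i` = a_{i+1}.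
record InfExec {Act : Set} (A : Automaton Act) : Set where
  field
    st     : ℕ → State A
    act    : ℕ → Act
    st-start : start A (st 0)
    st-step  : ∀ i → trans A (st i) (act i) (st (suc i))

open InfExec public

-- Finite execution with n actions; only st 0..n and act 0..n-1 are meaningful.
record FinExec {Act : Set} (A : Automaton Act) : Set where
  field
    len    : ℕ
    fst    : ℕ → State A
    fact   : ℕ → Act
    fst-start : start A (fst 0)
    fst-step  : ∀ i → i < len → trans A (fst i) (fact i) (fst (suc i))

open FinExec public

Extends : {Act : Set} {A : Automaton Act} → InfExec A → FinExec A → Set
Extends α β = (∀ i → i ≤ len β → st α i ≡ fst β i)
            × (∀ i → i < len β → act α i ≡ fact β i)

record CPair (S : Set) : Set₁ where
  field
    R : S → Set
    G : S → Set

open CPair public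

-- a set of complemented pairs (of arbitrary cardinality), as a predicate
PairSet : Set → Set₂
PairSet S = CPair S → Set₁

InfOften : {S : Set} → (ℕ → S) → (S → Set) → Set
InfOften f P = ∀ n → ∃ λ k → n ≤ k × P (f k)

_⊨_ : {Act : Set} {A : Automaton Act} → InfExec A → CPair (State A) → Set
α ⊨ p = InfOften (st α) (R p) → InfOften (st α) (G p)

InLExecs : {Act : Set} (A : Automaton Act) → PairSet (State A) → InfExec A → Set₁
InLExecs A L α = ∀ p → L p → α ⊨ p

IsLive : {Act : Set} (A : Automaton Act) → PairSet (State A) → Set₁
IsLive A L = (β : FinExec A) → Σ (InfExec A) λ α → Extends α β × InLExecs A L α

InLHat : {Act : Set} (A : Automaton Act) → PairSet (State A) → CPair (State A) → Set₁
InLHat A L p = (α : InfExec A) → InLExecs A L α → α ⊨ p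

-- actions b_{lo+1} … b_{hi}  (0-based: b lo, …, b (hi-1))
block : {Act : Set} → (ℕ → Act) → ℕ → ℕ → List Act
block b lo hi = map (λ k → b (lo + k)) (upTo (hi ∸ lo))

InRH : {Act : Set} {A B : Automaton Act} →
       (Rel : State A → State B → Set) →
       (M : PairSet (State B)) →
       (H : (q : CPair (State B)) → M q → CPair (State A)) →
       InfExec A → InfExec B → Set₁
InRH {A = A} {B} Rel M H α α' =
  Σ (ℕ → ℕ) λ m →
      (m 0 ≡ 0)
    × (∀ i → m i ≤ m (suc i))
    × (∀ i → Rel (st α i) (st α' (m i)))
    × (∀ i → trace (ext B) (block (act α') (m i) (m (suc i)))
               ≡ trace (ext A) (act α i ∷ []))
    × (∀ j → ∃ λ i → j ≤ m i)
    × (∀ q (mq : M q) i →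
         ((∃ λ j → m i ≤ j × j ≤ m (suc i) × R q (st α' j))
            → R (H q mq) (st α i) ⊎ R (H q mq) (st α (suc i)))
       × ((G (H q mq) (st α i) ⊎ G (H q mq) (st α (suc i)))
            → ∃ λ j → m i ≤ j × j ≤ m (suc i) × G q (st α' j)))

-- Let m be the step correspondence of (α, α') ∈ (R, H) and q ∈ M with p = H q.
-- Every step of α' lies in the block of some step i of α, so if α' visits q.R
-- infinitely often then α visits p.R infinitely often.  As p ∈ L̂ and α is live,
-- α visits p.G infinitely often, and each such visit forces a visit of α' to
-- q.G within the corresponding block; these blocks lie arbitrarily far out.
module Submission where

open import Defs
open import Data.Nat using (ℕ; suc; _≤_; _≤′_; ≤′-refl; ≤′-step; _≤?_)
open import Data.Nat.Properties
  using (≤-refl; ≤-trans; <⇒≤; ≰⇒>; m≤n⇒m≤1+n; m≤m+n; m≤n+m; ≤⇒≤′; ≤′⇒≤)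
open import Data.Product using (∃; _×_; _,_; proj₁; proj₂)
open import Data.Sum using (_⊎_; inj₁; inj₂)
open import Function using (_∘_)
open import Relation.Nullary using (yes; no)

InBlock : {U : Set} → (ℕ → ℕ) → (ℕ → U) → (U → Set) → ℕ → Set
InBlock m u Q i = ∃ λ j → m i ≤ j × j ≤ m (suc i) × Q (u j)

module _ {m : ℕ → ℕ} (m-step : ∀ i → m i ≤ m (suc i)) where

  m-mono′ : ∀ {i j} → i ≤′ j → m i ≤ m j
  m-mono′ ≤′-refl     = ≤-refl
  m-mono′ (≤′-step p) = ≤-trans (m-mono′ p) (m-step _)

  m-mono : ∀ {i j} → i ≤ j → m i ≤ m j
  m-mono = m-mono′ ∘ ≤⇒≤′

  block-between : ∀ {n j k} → n ≤′ j → m n ≤ k → k ≤ m j →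
                  ∃ λ i → n ≤ i × m i ≤ k × k ≤ m (suc i)
  block-between {n} ≤′-refl lo hi = n , ≤-refl , lo , ≤-trans hi (m-step n)
  block-between {k = k} (≤′-step {j} n≤j) lo hi with k ≤? m j
  ... | yes k≤mj = block-between n≤j lo k≤mj
  ... | no  k≰mj = j , ≤′⇒≤ n≤j , <⇒≤ (≰⇒> k≰mj) , hi

  module _ (m-unbounded : ∀ j → ∃ λ i → j ≤ m i) where

    block-containing : ∀ n {k} → m n ≤ k →
                       ∃ λ i → n ≤ i × m i ≤ k × k ≤ m (suc i)
    block-containing n {k} lo with m-unbounded k
    ... | i , k≤mi = block-between (≤⇒≤′ (m≤n+m n i)) lo
                                   (≤-trans k≤mi (m-mono (m≤m+n i n)))

    module _ {S U : Set} {s : ℕ → S} {u : ℕ → U} {P : S → Set} {Q : U → Set} where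

      infOften-fromBlocks : (∀ i → InBlock m u Q i → P (s i) ⊎ P (s (suc i))) →
                            InfOften u Q → InfOften s P
      infOften-fromBlocks reflect often n with often (m n)
      ... | k , mn≤k , Qk with block-containing n mn≤k
      ... | i , n≤i , mi≤k , k≤msi with reflect i (k , mi≤k , k≤msi , Qk)
      ... | inj₁ Pi  = i , n≤i , Pi
      ... | inj₂ Psi = suc i , m≤n⇒m≤1+n n≤i , Psi

      infOften-toBlocks : (∀ i → P (s i) → InBlock m u Q i) →
                          InfOften s P → InfOften u Q
      infOften-toBlocks witness often n with m-unbounded n
      ... | i₀ , n≤mi₀ with often i₀
      ... | i , i₀≤i , Pi with witness i Pi
      ... | j , mi≤j , _ , Qj = j , ≤-trans n≤mi₀ (≤-trans (m-mono i₀≤i) mi≤j) , Qj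

lemma8 : {Act : Set} (A B : Automaton Act)
    (L : PairSet (State A)) (M : PairSet (State B)) →
    IsLive A L → IsLive B M → SameExt A B →
    (Rel : State A → State B → Set) →
    (H : (q : CPair (State B)) → M q → CPair (State A)) →
    (H-hat : ∀ q (mq : M q) → InLHat A L (H q mq)) →
    (α : InfExec A) (α' : InfExec B) →
    InRH Rel M H α α' →
    InLExecs A L α → InLExecs B M α'
lemma8 A B L M _ _ _ Rel H H-hat α α'
       (m , _ , m-step , _ , _ , m-unbounded , pairs) α-live q mq =
  G-often ∘ H-hat q mq α α-live ∘ R-often
  where
    p : CPair (State A)
    p = H q mq

    R-often : InfOften (st α') (R q) → InfOften (st α) (R p)
    R-often = infOften-fromBlocks m-step m-unbounded {P = R p} {Q = R q}
                (proj₁ ∘ pairs q mq)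

    G-often : InfOften (st α) (G p) → InfOften (st α') (G q)
    G-often = infOften-toBlocks m-step m-unbounded {P = G p} {Q = G q}
                (λ i G-i → proj₂ (pairs q mq i) (inj₁ G-i))
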